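{- Let $\mathcal{S}=(\Sigma,\Omega)$ be a signature and let $\mathcal{C}$ be the category with finite products freely generated by $\mathcal{S}$, as described in the context. Let $(e,V,\sigma)$ and $(u,W,\tau)$ be terms, let $x\in V$ be a variable with $\mathrm{Type}[x]=\tau$ (so that $u$ may be substituted for $x$), and let $e[x\leftarrow u]$ denote the expression obtained from $e$ by replacing every occurrence of $x$ by $u$. Then there exists an arrow $$A:\prod\bigl((V\setminus\{x\})\cup W\bigr)\to \prod\bigl(V\cup W\bigr)$$ in $\mathcal{C}$ such that $$\mathrm{Arr}\bigl[e[x\leftarrow u],\,(V\setminus\{x\})\cup W,\,\sigma\bigr]=\mathrm{Arr}\bigl[e,\,V\cup W,\,\sigma\bigr]\circ A .$$
   Context: A signature $\mathcal{S}=(\Sigma,\Omega)$ consists of a set $\Sigma$ of types, a set $\Omega$ of operations, and functions $\mathrm{Inp}:\Omega\to\mathrm{List}[\Sigma]$ (input type list) and $\mathrm{Outp}:\Omega\to\Sigma$ (output type). The types are indexed as $\Sigma=\{\sigma^i\mid i\in I\}$ for an ordinal $I$; for each $i$ there are variables $x^i_j$ ($j\in\omega$) of type $\sigma^i$ (write $\mathrm{Type}[x^i_j]=\sigma^i$), and variables are totally ordered by $x^i_j<x^k_l$ iff $i<k$, or $i=k$ and $j<l$. Expressions of type $\tau$ are defined recursively: a variable of type $\tau$ is one; if $f\in\Omega$ with $\mathrm{Inp}[f]=(\gamma_1,\dots,\gamma_n)$, $\mathrm{Outp}[f]=\tau$ and $e_k$ is an expression of type $\gamma_k$ for each $k$,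 then $f(e_1,\dots,e_n)$ is one. $\mathrm{VarList}[e]$ is the list of variable occurrences of $e$ from left to right (with repetitions), $\mathrm{VarSet}[e]$ its set of entries, and $\mathrm{TypeList}[e]$ the list of the types of the entries of $\mathrm{VarList}[e]$. A term is a triple $(e,V,\sigma)$ with $e$ an expression of type $\sigma$ and $V$ a finite set of variables with $\mathrm{VarSet}[e]\subseteq V$; $V$ is listed in increasing order. For a finite set (or list) $V$ of variables, $\prod V$ denotes the product of the types of its elements in that order (the empty product is a terminal object). $\mathcal{C}$ is the category with finite products freely generated by the objects $\sigma\in\Sigma$ and arrows $f:\prod\mathrm{Inp}[f]\to\mathrm{Outp}[f]$ for $f\in\Omega$ (equivalently, the finite-product theory of the finite-product sketch whose nodes are the types and the input type lists of operations, whose arrows are the operations and the projections, and whose cones make each list node the product of its entries). For an expression $e$, define $Q[e]$ recursively: if $e$ is a variable of type $\tau$, $Q[e]=\mathrm{id}_\tau$; if $e=f(e_1,\dots,e_n)$, $Q[e]=f\circ\bigl(Q[e_1]\times\cdots\times Q[e_n]\bigr):\prod_{k}\mathrm{Dom}[Q[e_k]]\to\mathrm{Outp}[f]$ (for $n=0$ this is $f:1\to\mathrm{Outp}[f]$). Define $I[e]$ to be the canonical (associativity) isomorphism from the flat product $\prod\mathrm{TypeList}[e]$ to the nested product $\mathrm{Dom}[Q[e]]$. For a term $t=(e,V,\sigma)$, define $D[t]:\prod V\to\prod\mathrm{TypeList}[e]$ as the arrow whose $i$-th component is the projection of $\prod V$ onto the factor corresponding to the variable which is the $i$-th entry of $\mathrm{VarList}[e]$.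 Finally $\mathrm{Arr}[t]=Q[e]\circ I[e]\circ D[t]:\prod V\to\sigma$. -}

module Defs where

open import Data.Nat using (ℕ) renaming (_<_ to _<ℕ_)
import Data.Nat.Properties as ℕP
open import Data.List using (List; []; _∷_; _++_; filter)
open import Data.List.Relation.Unary.All using (All; []; _∷_)
open import Data.List.Relation.Unary.Linked using (Linked)
open import Data.List.Membership.Propositional using (_∈_)
open import Data.List.Relation.Unary.Any using (here; there)
open import Data.Product using (Σ; _×_; _,_; proj₁; proj₂)
open import Data.Sum using (_⊎_)
open import Relation.Binary.PropositionalEquality using (_≡_; refl)
open import Relation.Binary.Structures using (IsStrictTotalOrder)
open import Relation.Binary.Definitions using (tri<; tri≈; tri>)
open import Relation.Nullary using (yes; no; ¬?)
open import Relation.Binary using (Rel; DecidableEquality)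

-- Signatures.  The types Σ = {σ^i | i ∈ I} are indexed by an ordinal,
-- which we render as a set of sorts carrying a strict total order
-- (the order σ^i < σ^k iff i < k).

record Signature : Set₁ where
  field
    Sort     : Set
    _<ₛ_     : Rel Sort _
    sortSTO  : IsStrictTotalOrder _≡_ _<ₛ_
    Op       : Set
    Inp      : Op → List Sort
    Outp     : Op → Sort

module FP (S : Signature) where
  open Signature S

  _≟ₛ_ : DecidableEquality Sort
  _≟ₛ_ = IsStrictTotalOrder._≟_ sortSTO

  data Obj : Set where
    ι : Sort → Obj
    Π : List Obj → Obj

  data Idx : List Obj → Obj → Set where
    here  : ∀ {B Bs} → Idx (B ∷ Bs) B
    there : ∀ {B C Bs} → Idx Bs B → Idx (C ∷ Bs) B

  infixr 9 _∘_
  data _⇒_ : Obj → Obj → Set where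
    id    : ∀ {A} → A ⇒ A
    _∘_   : ∀ {A B C} → B ⇒ C → A ⇒ B → A ⇒ C
    op    : (f : Op) → Π (Data.List.map ι (Inp f)) ⇒ ι (Outp f)
    π     : ∀ {Bs B} → Idx Bs B → Π Bs ⇒ B
    tuple : ∀ {A Bs} → (∀ {B} → Idx Bs B → A ⇒ B) → A ⇒ Π Bs

  infix 4 _≈_
  data _≈_ : ∀ {A B} → A ⇒ B → A ⇒ B → Set where
    ≈-refl  : ∀ {A B} {f : A ⇒ B} → f ≈ f
    ≈-sym   : ∀ {A B} {f g : A ⇒ B} → f ≈ g → g ≈ f
    ≈-trans : ∀ {A B} {f g h : A ⇒ B} → f ≈ g → g ≈ h → f ≈ h
    ∘-cong  : ∀ {A B C} {f f' : B ⇒ C} {g g' : A ⇒ B} →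
              f ≈ f' → g ≈ g' → f ∘ g ≈ f' ∘ g'
    tuple-cong : ∀ {A Bs} {fs gs : ∀ {B} → Idx Bs B → A ⇒ B} →
              (∀ {B} (i : Idx Bs B) → fs i ≈ gs i) → tuple fs ≈ tuple gs
    idˡ     : ∀ {A B} {f : A ⇒ B} → id ∘ f ≈ f
    idʳ     : ∀ {A B} {f : A ⇒ B} → f ∘ id ≈ f
    assoc   : ∀ {A B C D} {f : C ⇒ D} {g : B ⇒ C} {h : A ⇒ B} →
              (f ∘ g) ∘ h ≈ f ∘ (g ∘ h)
    β       : ∀ {A Bs B} {fs : ∀ {C} → Idx Bs C → A ⇒ C} (i : Idx Bs B) →
              π i ∘ tuple fs ≈ fs i
    η       : ∀ {A Bs} {h : A ⇒ Π Bs} → tuple (λ i → π i ∘ h) ≈ h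

  data Arrs : List Obj → List Obj → Set where
    []  : Arrs [] []
    _∷_ : ∀ {A B As Bs} → A ⇒ B → Arrs As Bs → Arrs (A ∷ As) (B ∷ Bs)

  pick : ∀ {As Bs B} → Arrs As Bs → Idx Bs B → Σ Obj λ A → Idx As A × (A ⇒ B)
  pick (f ∷ fs) here      = _ , here , f
  pick (f ∷ fs) (there i) with pick fs i
  ... | A , j , g = A , there j , g

  prodArr : ∀ {As Bs} → Arrs As Bs → Π As ⇒ Π Bs
  prodArr fs = tuple (λ i → proj₂ (proj₂ (pick fs i)) ∘ π (proj₁ (proj₂ (pick fs i))))

  Var : Set
  Var = Sort × ℕ

  Type : Var → Sort
  Type = proj₁

  _<V_ : Rel Var _
  (s , j) <V (s' , j') = (s <ₛ s') ⊎ (s ≡ s' × j <ℕ j')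

  data Cmp : Set where lt eq gt : Cmp

  compareVar : Var → Var → Cmp
  compareVar (s , j) (s' , j') with IsStrictTotalOrder.compare sortSTO s s'
  ... | tri< _ _ _ = lt
  ... | tri> _ _ _ = gt
  ... | tri≈ _ _ _ with ℕP.<-cmp j j'
  ...   | tri< _ _ _ = lt
  ...   | tri≈ _ _ _ = eq
  ...   | tri> _ _ _ = gt

  _≟V_ : DecidableEquality Var
  (s , j) ≟V (s' , j') with s ≟ₛ s' | j ℕP.≟ j'
  ... | yes refl | yes refl = yes refl
  ... | no ¬p    | _        = no λ { refl → ¬p refl }
  ... | yes _    | no ¬q    = no λ { refl → ¬q refl }

  -- a finite set of variables is represented by its listing in
  -- increasing order
  IsFinSet : List Var → Set
  IsFinSet = Linked _<V_

  remove : Var → List Var → List Var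
  remove x V = filter (λ y → ¬? (y ≟V x)) V

  -- merge of increasing listings; r computes (xs ∪_), k is (x ∷ xs) ∪ ys
  mergeStep : Cmp → Var → (List Var → List Var) → Var → List Var → List Var → List Var
  mergeStep lt x r y ys k = x ∷ r (y ∷ ys)
  mergeStep eq x r y ys k = x ∷ r ys
  mergeStep gt x r y ys k = y ∷ k

  mergeAux : Var → List Var → (List Var → List Var) → List Var → List Var
  mergeAux x xs r []       = x ∷ xs
  mergeAux x xs r (y ∷ ys) = mergeStep (compareVar x y) x r y ys (mergeAux x xs r ys)

  infixr 5 _∪_
  _∪_ : List Var → List Var → List Var
  []       ∪ ys = ys
  (x ∷ xs) ∪ ys = mergeAux x xs (xs ∪_) ys

  obs : List Var → List Obj
  obs []       = []
  obs (x ∷ xs) = ι (Type x) ∷ obs xs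

  ∏ : List Var → Obj
  ∏ V = Π (obs V)

  -- Expressions; var {τ} j is the variable x^τ_j (of type τ)

  data Expr : Sort → Set
  data Args : List Sort → Set

  data Expr where
    var : ∀ {τ} → ℕ → Expr τ
    app : (f : Op) → Args (Inp f) → Expr (Outp f)

  data Args where
    []  : Args []
    _∷_ : ∀ {s ss} → Expr s → Args ss → Args (s ∷ ss)

  VarList  : ∀ {s} → Expr s → List Var
  VarListA : ∀ {ss} → Args ss → List Var
  VarList (var {τ} j) = (τ , j) ∷ []
  VarList (app f as)  = VarListA as
  VarListA []       = []
  VarListA (e ∷ as) = VarList e ++ VarListA as

  FlatObj : ∀ {s} → Expr s → Obj
  FlatObj e = ∏ (VarList e)

  subst  : ∀ {τ s} → ℕ → Expr τ → Expr s → Expr s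
  substA : ∀ {τ ss} → ℕ → Expr τ → Args ss → Args ss
  subst {τ} {s} j u (var k) with s ≟ₛ τ | k ℕP.≟ j
  ... | yes refl | yes refl = u
  ... | _        | _        = var k
  subst j u (app f as) = app f (substA j u as)
  substA j u []       = []
  substA j u (e ∷ as) = subst j u e ∷ substA j u as

  Dom  : ∀ {s} → Expr s → Obj
  DomA : ∀ {ss} → Args ss → List Obj
  Dom (var {τ} j) = ι τ
  Dom (app f as)  = Π (DomA as)
  DomA []       = []
  DomA (e ∷ as) = Dom e ∷ DomA as

  Q  : ∀ {s} (e : Expr s) → Dom e ⇒ ι s
  QA : ∀ {ss} (as : Args ss) → Arrs (DomA as) (Data.List.map ι ss)
  Q (var j)    = id
  Q (app f as) = op f ∘ prodArr (QA as)
  QA []       = []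
  QA (e ∷ as) = Q e ∷ QA as

  injL : ∀ {B} (xs ys : List Var) → Idx (obs xs) B → Idx (obs (xs ++ ys)) B
  injL (x ∷ xs) ys here      = here
  injL (x ∷ xs) ys (there i) = there (injL xs ys i)

  injR : ∀ {B} (xs : List Var) {ys : List Var} → Idx (obs ys) B → Idx (obs (xs ++ ys)) B
  injR []       i = i
  injR (x ∷ xs) i = there (injR xs i)

  projL : (xs ys : List Var) → ∏ (xs ++ ys) ⇒ ∏ xs
  projL xs ys = tuple (λ i → π (injL xs ys i))

  projR : (xs ys : List Var) → ∏ (xs ++ ys) ⇒ ∏ ys
  projR xs ys = tuple (λ i → π (injR xs i))

  -- canonical iso from the flat product to the nested product
  I   : ∀ {s} (e : Expr s) → FlatObj e ⇒ Dom e
  IA  : ∀ {ss} (as : Args ss) → ∏ (VarListA as) ⇒ Π (DomA as)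
  IAc : ∀ {ss B} (as : Args ss) → Idx (DomA as) B → ∏ (VarListA as) ⇒ B
  I (var j)    = π here
  I (app f as) = IA as
  IA as = tuple (IAc as)
  IAc (e ∷ as) here      = I e ∘ projL (VarList e) (VarListA as)
  IAc (e ∷ as) (there i) = IAc as i ∘ projR (VarList e) (VarListA as)

  toIdx : ∀ {x V} → x ∈ V → Idx (obs V) (ι (Type x))
  toIdx (here refl) = here
  toIdx (there p)   = there (toIdx p)

  sel : ∀ {V xs B} → All (_∈ V) xs → Idx (obs xs) B → Idx (obs V) B
  sel (p ∷ ps) here      = toIdx p
  sel (p ∷ ps) (there i) = sel ps i

  D : ∀ {s} (e : Expr s) (V : List Var) → All (_∈ V) (VarList e) → ∏ V ⇒ FlatObj e
  D e V p = tuple (λ i → π (sel p i))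

  -- Arr[(e, V, σ)]; the All-argument witnesses VarSet[e] ⊆ V
  Arr : ∀ {σ} (e : Expr σ) (V : List Var) → All (_∈ V) (VarList e) → ∏ V ⇒ ι σ
  Arr e V p = Q e ∘ I e ∘ D e V p

{-# OPTIONS --safe #-}
module Submission where

-- Arr[e, L] ∘ g is the interpretation ⟦ e ⟧ g of e at the generalised element g of ∏ L,
-- each variable being read off g by its projection.  Interpretation commutes with
-- substitution: ⟦ e[x ← u] ⟧ g ≈ ⟦ e ⟧ A, where A has x-component ⟦ u ⟧ g and projections
-- of g elsewhere; take g = id on ∏((V ∖ {x}) ∪ W).  The one subtlety is that ⟦_⟧ depends
-- on how the variables are located in the list; this is harmless because the sorted
-- listing (V ∖ {x}) ∪ W has no repetitions, so membership proofs are unique.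

open import Defs
open import Function using (_∘′_)
open import Data.Nat using (ℕ; _<_)
import Data.Nat.Properties as ℕP
open import Data.List using (List; []; _∷_; _++_; map)
open import Data.List.Relation.Unary.All as All using (All; []; _∷_)
open import Data.List.Relation.Unary.All.Properties using (++⁻ˡ; ++⁻ʳ)
open import Data.List.Relation.Unary.AllPairs as AllPairs using (AllPairs; []; _∷_)
import Data.List.Relation.Unary.AllPairs.Properties as AllPairsₚ
open import Data.List.Relation.Unary.Linked.Properties using (Linked⇒AllPairs)
open import Data.List.Relation.Unary.Unique.Propositional using (Unique)
open import Data.List.Relation.Unary.Any using (here; there)
open import Data.List.Membership.Propositional using (_∈_)
open import Data.List.Membership.Propositional.Properties using (∈-filter⁺)
open import Data.List.Membership.Setoid.Properties using (unique⇒irrelevant)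
open import Data.Product using (Σ; _,_; proj₁; proj₂)
open import Data.Product.Relation.Binary.Lex.Strict using (×-transitive; ×-irreflexive)
open import Data.Sum using (_⊎_; inj₁; inj₂)
open import Data.Empty using (⊥)
open import Relation.Binary using (Setoid; Transitive)
open import Relation.Binary.PropositionalEquality
  using (_≡_; _≢_; refl; cong; isEquivalence; setoid)
open import Relation.Binary.Structures using (IsStrictTotalOrder)
open import Relation.Binary.Definitions using (tri<; tri≈; tri>)
open import Relation.Nullary using (yes; no; ¬?)
open import Relation.Unary using (Irrelevant)
open import Axiom.UniquenessOfIdentityProofs using (module Decidable⇒UIP)
import Relation.Binary.Reasoning.Setoid as SetoidReasoning

module _ (S : Signature) where
  open Signature S
  open FP S
  private module Sort = IsStrictTotalOrder sortSTO

  <V-trans : Transitive _<V_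
  <V-trans = ×-transitive {_≈₁_ = _≡_} {_<ₛ_} {_<_} isEquivalence Sort.<-resp-≈ Sort.trans ℕP.<-trans

  <V-irrefl : ∀ {x} → x <V x → ⊥
  <V-irrefl = ×-irreflexive {_≈₁_ = _≡_} {_<ₛ_} {_≈₂_ = _≡_} {_<_} Sort.irrefl ℕP.<-irrefl (refl , refl)

  CompareVar : Var → Var → Cmp → Set
  CompareVar x y lt = x <V y
  CompareVar x y eq = x ≡ y
  CompareVar x y gt = y <V x

  compareVar-sound : ∀ x y → CompareVar x y (compareVar x y)
  compareVar-sound (s , j) (s' , j') with Sort.compare s s'
  ... | tri< s<s' _ _ = inj₁ s<s'
  ... | tri> _ _ s'<s = inj₁ s'<s
  ... | tri≈ _ refl _ with ℕP.<-cmp j j'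
  ...   | tri< j<j' _ _ = inj₂ (refl , j<j')
  ...   | tri≈ _ refl _ = refl
  ...   | tri> _ _ j'<j = inj₂ (refl , j'<j)

  Sorted : List Var → Set
  Sorted = AllPairs _<V_

  IsFinSet⇒Sorted : ∀ {xs} → IsFinSet xs → Sorted xs
  IsFinSet⇒Sorted = Linked⇒AllPairs <V-trans

  Sorted⇒Unique : ∀ {xs} → Sorted xs → Unique xs
  Sorted⇒Unique = AllPairs.map λ { x<x refl → <V-irrefl x<x }

  All-∪⁺ : ∀ {P : Var → Set} {xs ys} → All P xs → All P ys → All P (xs ∪ ys)
  All-∪⁺ {xs = []} _ pys = pys
  All-∪⁺ {P} {x ∷ xs} (px ∷ pxs) = merge
    where
    merge : ∀ {ys} → All P ys → All P (mergeAux x xs (xs ∪_) ys)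
    merge {[]} [] = px ∷ pxs
    merge {y ∷ ys} (py ∷ pys) with compareVar x y
    ... | lt = px ∷ All-∪⁺ pxs (py ∷ pys)
    ... | eq = px ∷ All-∪⁺ pxs pys
    ... | gt = py ∷ merge pys

  ∈-∪⁺ˡ : ∀ {z} xs ys → z ∈ xs → z ∈ xs ∪ ys
  ∈-∪⁺ˡ {z} (x ∷ xs) ys = merge ys
    where
    merge : ∀ ys → z ∈ x ∷ xs → z ∈ mergeAux x xs (xs ∪_) ys
    merge [] z∈ = z∈
    merge (y ∷ ys) z∈ with compareVar x y | z∈
    ... | lt | here z≡x = here z≡x
    ... | lt | there z∈xs = there (∈-∪⁺ˡ xs (y ∷ ys) z∈xs)
    ... | eq | here z≡x = here z≡x
    ... | eq | there z∈xs = there (∈-∪⁺ˡ xs ys z∈xs)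
    ... | gt | _ = there (merge ys z∈)

  ∈-∪⁺ʳ : ∀ {z} xs {ys} → z ∈ ys → z ∈ xs ∪ ys
  ∈-∪⁺ʳ [] z∈ = z∈
  ∈-∪⁺ʳ {z} (x ∷ xs) = merge
    where
    merge : ∀ {ys} → z ∈ ys → z ∈ mergeAux x xs (xs ∪_) ys
    merge {y ∷ ys} z∈ with compareVar x y | compareVar-sound x y | z∈
    ... | lt | _    | _ = there (∈-∪⁺ʳ xs z∈)
    ... | eq | refl | here z≡x = here z≡x
    ... | eq | _    | there z∈ys = there (∈-∪⁺ʳ xs z∈ys)
    ... | gt | _    | here z≡y = here z≡y
    ... | gt | _    | there z∈ys = there (merge z∈ys)

  ∈-∪⁻ : ∀ {z} xs ys → z ∈ xs ∪ ys → z ∈ xs ⊎ z ∈ ys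
  ∈-∪⁻ [] ys z∈ = inj₂ z∈
  ∈-∪⁻ {z} (x ∷ xs) ys = merge ys
    where
    thereˡ : ∀ {ys'} → z ∈ xs ⊎ z ∈ ys' → z ∈ x ∷ xs ⊎ z ∈ ys'
    thereˡ (inj₁ z∈xs) = inj₁ (there z∈xs)
    thereˡ (inj₂ z∈ys) = inj₂ z∈ys

    thereʳ : ∀ {xs' y ys'} → z ∈ xs' ⊎ z ∈ ys' → z ∈ xs' ⊎ z ∈ y ∷ ys'
    thereʳ (inj₁ z∈xs) = inj₁ z∈xs
    thereʳ (inj₂ z∈ys) = inj₂ (there z∈ys)

    merge : ∀ ys → z ∈ mergeAux x xs (xs ∪_) ys → z ∈ x ∷ xs ⊎ z ∈ ys
    merge [] z∈ = inj₁ z∈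
    merge (y ∷ ys) z∈ with compareVar x y | z∈
    ... | lt | here z≡x = inj₁ (here z≡x)
    ... | lt | there z∈' = thereˡ (∈-∪⁻ xs (y ∷ ys) z∈')
    ... | eq | here z≡x = inj₁ (here z≡x)
    ... | eq | there z∈' = thereʳ (thereˡ (∈-∪⁻ xs ys z∈'))
    ... | gt | here z≡y = inj₂ (here z≡y)
    ... | gt | there z∈' = thereʳ (merge ys z∈')

  Sorted-∪⁺ : ∀ {xs ys} → Sorted xs → Sorted ys → Sorted (xs ∪ ys)
  Sorted-∪⁺ {[]} _ ys↑ = ys↑
  Sorted-∪⁺ {x ∷ xs} (x<xs ∷ xs↑) = merge
    where
    merge : ∀ {ys} → Sorted ys → Sorted (mergeAux x xs (xs ∪_) ys)
    merge {[]} [] = x<xs ∷ xs↑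
    merge {y ∷ ys} (y<ys ∷ ys↑) with compareVar x y | compareVar-sound x y
    ... | lt | x<y  = All-∪⁺ x<xs (x<y ∷ All.map (<V-trans x<y) y<ys) ∷ Sorted-∪⁺ xs↑ (y<ys ∷ ys↑)
    ... | eq | refl = All-∪⁺ x<xs y<ys ∷ Sorted-∪⁺ xs↑ ys↑
    ... | gt | y<x  = All-∪⁺ {xs = x ∷ xs} (y<x ∷ All.map (<V-trans y<x) x<xs) y<ys ∷ merge ys↑

  ∈-remove-∪⁺ : ∀ {x y} V W → y ∈ V ∪ W → y ≢ x → y ∈ remove x V ∪ W
  ∈-remove-∪⁺ {x} V W y∈ y≢x with ∈-∪⁻ V W y∈
  ... | inj₁ y∈V = ∈-∪⁺ˡ (remove x V) W (∈-filter⁺ (λ z → ¬? (z ≟V x)) y∈V y≢x)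
  ... | inj₂ y∈W = ∈-∪⁺ʳ (remove x V) y∈W

  ∈-irrelevant : ∀ {L} → Unique L → Irrelevant (_∈ L)
  ∈-irrelevant = unique⇒irrelevant (setoid Var) (Decidable⇒UIP.≡-irrelevant _≟V_)

  hom-setoid : Obj → Obj → Setoid _ _
  hom-setoid A B = record
    { Carrier = A ⇒ B
    ; _≈_ = _≈_
    ; isEquivalence = record { refl = ≈-refl ; sym = ≈-sym ; trans = ≈-trans }
    }

  module ≈-Reasoning {A B : Obj} = SetoidReasoning (hom-setoid A B)

  ≡⇒≈ : ∀ {A B} {f g : A ⇒ B} → f ≡ g → f ≈ g
  ≡⇒≈ refl = ≈-refl

  π∘tuple∘ : ∀ {A C Bs B} {fs : ∀ {B'} → Idx Bs B' → A ⇒ B'} {h : C ⇒ A} (i : Idx Bs B) →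
             π i ∘ (tuple fs ∘ h) ≈ fs i ∘ h
  π∘tuple∘ i = ≈-trans (≈-sym assoc) (∘-cong (β i) ≈-refl)

  tuple∘ : ∀ {A C Bs} {fs : ∀ {B} → Idx Bs B → A ⇒ B} {h : C ⇒ A} →
           tuple fs ∘ h ≈ tuple (λ i → fs i ∘ h)
  tuple∘ = ≈-trans (≈-sym η) (tuple-cong π∘tuple∘)

  tabulate∈ᶜ : ∀ {C} L → (∀ {y} → y ∈ L → C ⇒ ι (Type y)) → ∀ {B} → Idx (obs L) B → C ⇒ B
  tabulate∈ᶜ (y ∷ L) f here      = f (here refl)
  tabulate∈ᶜ (y ∷ L) f (there i) = tabulate∈ᶜ L (f ∘′ there) i

  tabulate∈ : ∀ {C} L → (∀ {y} → y ∈ L → C ⇒ ι (Type y)) → C ⇒ ∏ L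
  tabulate∈ L f = tuple (tabulate∈ᶜ L f)

  tabulate∈ᶜ-toIdx : ∀ {C} L (f : ∀ {y} → y ∈ L → C ⇒ ι (Type y)) {y} (y∈L : y ∈ L) →
                     tabulate∈ᶜ L f (toIdx y∈L) ≡ f y∈L
  tabulate∈ᶜ-toIdx (y ∷ L) f (here refl) = refl
  tabulate∈ᶜ-toIdx (y ∷ L) f (there y∈L) = tabulate∈ᶜ-toIdx L (f ∘′ there) y∈L

  π∘tabulate∈ : ∀ {C} L (f : ∀ {y} → y ∈ L → C ⇒ ι (Type y)) {y} (y∈L : y ∈ L) →
                π (toIdx y∈L) ∘ tabulate∈ L f ≈ f y∈L
  π∘tabulate∈ L f y∈L = ≈-trans (β (toIdx y∈L)) (≡⇒≈ (tabulate∈ᶜ-toIdx L f y∈L))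

  ⟦_⟧ : ∀ {s} (e : Expr s) {C L} → C ⇒ ∏ L → All (_∈ L) (VarList e) → C ⇒ ι s
  ⟦_⟧ᴬ : ∀ {ss} (as : Args ss) {C L} → C ⇒ ∏ L → All (_∈ L) (VarListA as) →
         ∀ {B} → Idx (map ι ss) B → C ⇒ B
  ⟦ var j ⟧ g (x∈L ∷ []) = π (toIdx x∈L) ∘ g
  ⟦ app f as ⟧ g p = op f ∘ tuple (⟦ as ⟧ᴬ g p)
  ⟦ e ∷ as ⟧ᴬ g p here      = ⟦ e ⟧ g (++⁻ˡ (VarList e) p)
  ⟦ e ∷ as ⟧ᴬ g p (there i) = ⟦ as ⟧ᴬ g (++⁻ʳ (VarList e) p) i

  Picks : ∀ {C L xs} → All (_∈ L) xs → C ⇒ ∏ L → C ⇒ ∏ xs → Set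
  Picks {xs = xs} p g h = ∀ {B} (i : Idx (obs xs) B) → π i ∘ h ≈ π (sel p i) ∘ g

  sel-injL : ∀ {L B} xs ys (p : All (_∈ L) (xs ++ ys)) (i : Idx (obs xs) B) →
             sel p (injL xs ys i) ≡ sel (++⁻ˡ xs p) i
  sel-injL (x ∷ xs) ys (_ ∷ p) here      = refl
  sel-injL (x ∷ xs) ys (_ ∷ p) (there i) = sel-injL xs ys p i

  sel-injR : ∀ {L B} xs ys (p : All (_∈ L) (xs ++ ys)) (i : Idx (obs ys) B) →
             sel p (injR xs i) ≡ sel (++⁻ʳ xs p) i
  sel-injR []       ys p       i = refl
  sel-injR (x ∷ xs) ys (_ ∷ p) i = sel-injR xs ys p i

  D-picks : ∀ {s C L} (e : Expr s) (p : All (_∈ L) (VarList e)) (g : C ⇒ ∏ L) →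
            Picks p g (D e L p ∘ g)
  D-picks e p g = π∘tuple∘

  projL-picks : ∀ {C L} xs ys {p : All (_∈ L) (xs ++ ys)} {g : C ⇒ ∏ L} {h} →
                Picks p g h → Picks (++⁻ˡ xs p) g (projL xs ys ∘ h)
  projL-picks xs ys {p} {g} {h} picks i = begin
    π i ∘ (projL xs ys ∘ h)      ≈⟨ π∘tuple∘ i ⟩
    π (injL xs ys i) ∘ h         ≈⟨ picks (injL xs ys i) ⟩
    π (sel p (injL xs ys i)) ∘ g ≡⟨ cong (λ k → π k ∘ g) (sel-injL xs ys p i) ⟩
    π (sel (++⁻ˡ xs p) i) ∘ g    ∎
    where open ≈-Reasoning

  projR-picks : ∀ {C L} xs ys {p : All (_∈ L) (xs ++ ys)} {g : C ⇒ ∏ L} {h} →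
                Picks p g h → Picks (++⁻ʳ xs p) g (projR xs ys ∘ h)
  projR-picks xs ys {p} {g} {h} picks i = begin
    π i ∘ (projR xs ys ∘ h)    ≈⟨ π∘tuple∘ i ⟩
    π (injR xs i) ∘ h          ≈⟨ picks (injR xs i) ⟩
    π (sel p (injR xs i)) ∘ g  ≡⟨ cong (λ k → π k ∘ g) (sel-injR xs ys p i) ⟩
    π (sel (++⁻ʳ xs p) i) ∘ g  ∎
    where open ≈-Reasoning

  Q∘I-picks : ∀ {s C L} (e : Expr s) {p : All (_∈ L) (VarList e)} {g : C ⇒ ∏ L} {h} →
              Picks p g h → Q e ∘ (I e ∘ h) ≈ ⟦ e ⟧ g p
  QA∘IA-picks : ∀ {ss C L} (as : Args ss) {p : All (_∈ L) (VarListA as)} {g : C ⇒ ∏ L} {h} →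
                Picks p g h → ∀ {B} (i : Idx (map ι ss) B) →
                let (_ , k , f) = pick (QA as) i in f ∘ (IAc as k ∘ h) ≈ ⟦ as ⟧ᴬ g p i
  Q∘I-picks (var j) {_ ∷ []} picks = ≈-trans idˡ (picks here)
  Q∘I-picks (app f as) {p} {g} {h} picks = begin
    (op f ∘ prodArr (QA as)) ∘ (tuple (IAc as) ∘ h)
      ≈⟨ assoc ⟩
    op f ∘ (prodArr (QA as) ∘ (tuple (IAc as) ∘ h))
      ≈⟨ ∘-cong ≈-refl (≈-trans tuple∘ (tuple-cong λ i → ≈-trans assoc (∘-cong ≈-refl (π∘tuple∘ _)))) ⟩
    op f ∘ tuple (λ i → let (_ , k , f) = pick (QA as) i in f ∘ (IAc as k ∘ h))
      ≈⟨ ∘-cong ≈-refl (tuple-cong (QA∘IA-picks as picks)) ⟩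
    op f ∘ tuple (⟦ as ⟧ᴬ g p)
      ∎
    where open ≈-Reasoning
  QA∘IA-picks (e ∷ as) picks here =
    ≈-trans (∘-cong ≈-refl assoc) (Q∘I-picks e (projL-picks (VarList e) (VarListA as) picks))
  QA∘IA-picks (e ∷ as) picks (there i) =
    ≈-trans (∘-cong ≈-refl assoc) (QA∘IA-picks as (projR-picks (VarList e) (VarListA as) picks) i)

  Arr∘≈⟦⟧ : ∀ {s C L} (e : Expr s) (p : All (_∈ L) (VarList e)) (g : C ⇒ ∏ L) →
            Arr e L p ∘ g ≈ ⟦ e ⟧ g p
  Arr∘≈⟦⟧ {L = L} e p g = begin
    (Q e ∘ I e ∘ D e L p) ∘ g    ≈⟨ ≈-trans assoc (∘-cong ≈-refl assoc) ⟩
    Q e ∘ (I e ∘ (D e L p ∘ g))  ≈⟨ Q∘I-picks e (D-picks e p g) ⟩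
    ⟦ e ⟧ g p                    ∎
    where open ≈-Reasoning

  module _ {τ C L L'} (j : ℕ) (u : Expr τ) (g : C ⇒ ∏ L') (A : C ⇒ ∏ L)
           (subst-var : ∀ {s} k (m : (s , k) ∈ L) q → ⟦ subst j u (var {s} k) ⟧ g q ≈ π (toIdx m) ∘ A)
           where

    ⟦⟧-subst : ∀ {s} (e : Expr s) p q → ⟦ subst j u e ⟧ g q ≈ ⟦ e ⟧ A p
    ⟦⟧ᴬ-subst : ∀ {ss} (as : Args ss) p q {B} (i : Idx (map ι ss) B) →
                ⟦ substA j u as ⟧ᴬ g q i ≈ ⟦ as ⟧ᴬ A p i
    ⟦⟧-subst (var k) (m ∷ []) q = subst-var k m q
    ⟦⟧-subst (app f as) p q = ∘-cong ≈-refl (tuple-cong (⟦⟧ᴬ-subst as p q))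
    ⟦⟧ᴬ-subst (e ∷ as) p q here =
      ⟦⟧-subst e (++⁻ˡ (VarList e) p) (++⁻ˡ (VarList (subst j u e)) q)
    ⟦⟧ᴬ-subst (e ∷ as) p q (there i) =
      ⟦⟧ᴬ-subst as (++⁻ʳ (VarList e) p) (++⁻ʳ (VarList (subst j u e)) q) i

  module Substitution {τ} (j : ℕ) (u : Expr τ) {U U' : List Var} (U'-unique : Unique U')
                      (u⊆U' : All (_∈ U') (VarList u))
                      (U∖x⊆U' : ∀ {y} → y ∈ U → y ≢ (τ , j) → y ∈ U') where

    subst-var⊆U' : ∀ {s} k → (s , k) ∈ U → All (_∈ U') (VarList (subst j u (var {s} k)))
    subst-var⊆U' {s} k m with s ≟ₛ τ | k ℕP.≟ j
    ... | yes refl | yes refl = u⊆U'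
    ... | no s≢τ   | _        = U∖x⊆U' m (s≢τ ∘′ cong proj₁) ∷ []
    ... | yes refl | no k≢j   = U∖x⊆U' m (k≢j ∘′ cong proj₂) ∷ []

    A : ∏ U' ⇒ ∏ U
    A = tabulate∈ U λ {y} m → ⟦ subst j u (var {Type y} (proj₂ y)) ⟧ id (subst-var⊆U' (proj₂ y) m)

    A-var : ∀ {s} k (m : (s , k) ∈ U) q → ⟦ subst j u (var {s} k) ⟧ id q ≈ π (toIdx m) ∘ A
    A-var k m q = begin
      ⟦ subst j u (var k) ⟧ id q                  ≡⟨ cong (⟦ subst j u (var k) ⟧ id) q≡ ⟩
      ⟦ subst j u (var k) ⟧ id (subst-var⊆U' k m) ≈˘⟨ π∘tabulate∈ U _ m ⟩
      π (toIdx m) ∘ A                             ∎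
      where
      open ≈-Reasoning
      q≡ : q ≡ subst-var⊆U' k m
      q≡ = All.irrelevant (∈-irrelevant U'-unique) q (subst-var⊆U' k m)

    Arr-subst : ∀ {σ} (e : Expr σ) p q → Arr (subst j u e) U' q ≈ Arr e U p ∘ A
    Arr-subst e p q = begin
      Arr (subst j u e) U' q       ≈˘⟨ idʳ ⟩
      Arr (subst j u e) U' q ∘ id  ≈⟨ Arr∘≈⟦⟧ (subst j u e) q id ⟩
      ⟦ subst j u e ⟧ id q         ≈⟨ ⟦⟧-subst j u id A A-var e p q ⟩
      ⟦ e ⟧ A p                    ≈˘⟨ Arr∘≈⟦⟧ e p A ⟩
      Arr e U p ∘ A                ∎
      where open ≈-Reasoning

mainTheorem1 : (S : Signature) → let open Signature S in let open FP S in
    ∀ {σ τ : Sort} (e : Expr σ) (V : List Var) (u : Expr τ) (W : List Var) (j : ℕ) →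
    IsFinSet V → IsFinSet W →
    All (_∈ V) (VarList e) → All (_∈ W) (VarList u) →
    (τ , j) ∈ V →
    (p : All (_∈ (V ∪ W)) (VarList e)) →
    (q : All (_∈ (remove (τ , j) V ∪ W)) (VarList (subst j u e))) →
    Σ (∏ (remove (τ , j) V ∪ W) ⇒ ∏ (V ∪ W))
      (λ A → Arr (subst j u e) (remove (τ , j) V ∪ W) q ≈ (Arr e (V ∪ W) p ∘ A))
mainTheorem1 S {τ = τ} e V u W j V-set W-set _ u⊆W _ p q = A , Arr-subst e p q
  where
  open FP S
  x : Var
  x = (τ , j)

  V∖x-sorted : Sorted S (remove x V)
  V∖x-sorted = AllPairsₚ.filter⁺ (λ y → ¬? (y ≟V x)) (IsFinSet⇒Sorted S V-set)

  V∖x∪W-unique : Unique (remove x V ∪ W)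
  V∖x∪W-unique = Sorted⇒Unique S (Sorted-∪⁺ S V∖x-sorted (IsFinSet⇒Sorted S W-set))

  open Substitution S j u {V ∪ W} V∖x∪W-unique (All.map (∈-∪⁺ʳ S (remove x V)) u⊆W)
                        (∈-remove-∪⁺ S V W)
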